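{- Let $H$ be a graph and let $G$ be obtained from $H$ by adding a matching, i.e. a set of new edges between vertices of $H$ (not already edges of $H$) no two of which share a vertex. If $G$ is word-representable, then $H$ is $1$-$11$-representable.
   Context: Two distinct letters $x,y$ alternate in a word $w$ if the subsequence of $w$ formed by all occurrences of $x$ and $y$ is of the form $xyxy\cdots$ or $yxyx\cdots$. A graph $G=(V,E)$ is word-representable if there is a word $w$ over $V$ such that for all distinct $x,y\in V$, $x$ and $y$ alternate in $w$ if and only if $xy\in E$. For a word $w$ and letters $x,y$, let $w|_{\{x,y\}}$ be the subsequence of $w$ of all occurrences of $x$ and $y$. A graph $H=(V,E)$ is $1$-$11$-representable if there is a word $w$ over $V$ (each vertex occurring) such that for all distinct $x,y\in V$, the total number of occurrences of the factors $xx$ and $yy$ in $w|_{\{x,y\}}$ is at most $1$ if and only if $xy\in E$. -}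

module Defs where

open import Data.Nat using (ℕ; zero; suc; _≤_)
open import Data.Fin using (Fin; _≟_)
open import Data.List using (List; []; _∷_; filter)
open import Data.List.Membership.Propositional using (_∈_)
open import Data.Sum using (_⊎_)
open import Data.Product using (_×_)
open import Relation.Nullary using (¬_; Dec; yes; no)
open import Relation.Nullary.Decidable using (_⊎-dec_)
open import Relation.Binary.PropositionalEquality using (_≡_)
open import Function.Bundles using (_⇔_)

record IsSimpleGraph {n : ℕ} (E : Fin n → Fin n → Set) : Set where
  field
    symmetric   : ∀ x y → E x y → E y x
    irreflexive : ∀ x → ¬ E x x

restrict : {n : ℕ} → List (Fin n) → Fin n → Fin n → List (Fin n)
restrict w x y = filter (λ z → (z ≟ x) ⊎-dec (z ≟ y)) w

data AltFrom {n : ℕ} (x y : Fin n) : List (Fin n) → Set where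
  alt-nil  : AltFrom x y []
  alt-cons : ∀ {u} → AltFrom y x u → AltFrom x y (x ∷ u)

Alternate : {n : ℕ} → List (Fin n) → Fin n → Fin n → Set
Alternate w x y = AltFrom x y (restrict w x y) ⊎ AltFrom y x (restrict w x y)

AllOccur : {n : ℕ} → List (Fin n) → Set
AllOccur {n} w = ∀ (v : Fin n) → v ∈ w

WordRepresentable : {n : ℕ} → (Fin n → Fin n → Set) → Set
WordRepresentable {n} E =
  Σ' (List (Fin n)) λ w → AllOccur w ×
    (∀ (x y : Fin n) → ¬ x ≡ y → (Alternate w x y ⇔ E x y))
  where
    open import Data.Product using () renaming (Σ to Σ')

-- Number of occurrences (overlapping) of factors aa (a any letter) in u.
-- Applied to w|_{x,y} this is the total number of occurrences of xx and yy.
repeatsFrom : {n : ℕ} → Fin n → List (Fin n) → ℕ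
repeatsFrom a [] = zero
repeatsFrom a (b ∷ u) with a ≟ b
... | yes _ = suc (repeatsFrom b u)
... | no  _ = repeatsFrom b u

repeats : {n : ℕ} → List (Fin n) → ℕ
repeats [] = zero
repeats (a ∷ u) = repeatsFrom a u

OneElevenRepresentable : {n : ℕ} → (Fin n → Fin n → Set) → Set
OneElevenRepresentable {n} E =
  Σ' (List (Fin n)) λ w → AllOccur w ×
    (∀ (x y : Fin n) → ¬ x ≡ y → (repeats (restrict w x y) ≤ 1 ⇔ E x y))
  where
    open import Data.Product using () renaming (Σ to Σ')

record IsAddedMatching {n : ℕ} (H M : Fin n → Fin n → Set) : Set where
  field
    symmetric   : ∀ x y → M x y → M y x
    irreflexive : ∀ x → ¬ M x x
    new         : ∀ x y → M x y → ¬ H x y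
    disjoint    : ∀ x y z → M x y → M x z → y ≡ z

addEdges : {n : ℕ} → (Fin n → Fin n → Set) → (Fin n → Fin n → Set) → (Fin n → Fin n → Set)
addEdges H M x y = H x y ⊎ M x y

-- On a pair {x, y}, the restriction u of a word representing H + M alternates exactly when xy is an
-- edge of H or of M, i.e. when u contains no factor xx or yy. Group the vertices into the classes
-- {a, b} of the matching and {v} of unmatched vertices, and let σ list all classes, then all classes
-- reversed, then all classes again: its restriction σ' is (pq)³ when xy ∉ M and pqqppq when xy ∈ M,
-- where {p, q} = {x, y}. In w σ (reverse w) the restriction becomes u σ' (reverse u). A repeat in u
-- occurs again in reverse u, a matching edge forces two repeats inside σ', and otherwise only the
-- two seams can repeat, and not both, because σ' starts and ends with different letters. So at most
-- one repeat remains iff xy ∈ H.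

module Submission where

open import Defs
open import Data.Nat using (ℕ; zero; suc; _+_; _≤_; z≤n; s≤s)
import Data.Nat as ℕ
open import Data.Nat.Properties using (+-suc; +-assoc; +-comm; +-identityʳ; m≤n+m; ≤-trans; ≤-refl; +-monoʳ-≤; module ≤-Reasoning)
open import Data.Fin using (Fin; zero; suc; _≟_; _<_)
open import Data.Fin.Properties using (suc-injective; any?; _<?_; <-cmp; <-asym)
open import Data.List using (List; []; _∷_; _++_; filter; reverse; _ʳ++_)
open import Data.List.Properties using (filter-++; filter-accept; filter-reject; ++-identityʳ)
open import Data.List.Relation.Unary.All as All using (All; _∷_)
open import Data.List.Relation.Unary.All.Properties using (all-filter)
open import Data.List.Membership.Propositional.Properties using (∈-++⁺ˡ)
open import Data.Sum using (_⊎_; inj₁; inj₂; swap; [_,_])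
import Data.Sum as Sum
open import Data.Product using (∃; _×_; _,_)
open import Relation.Nullary using (¬_; Dec; yes; no; does; contradiction)
open import Data.Bool using (true; false)
open import Relation.Unary using (Decidable)
open import Relation.Nullary.Decidable using (_×-dec_; _⊎-dec_; map′)
open import Relation.Binary using (tri<; tri≈; tri>)
open import Function.Bundles using (_⇔_; mk⇔; Equivalence)
open import Relation.Binary.PropositionalEquality using (_≡_; refl; sym; trans; cong; cong₂; subst; module ≡-Reasoning)

module _ {n : ℕ} where

  adjRepeat : Fin n → Fin n → ℕ
  adjRepeat a b = repeatsFrom a (b ∷ [])

  repeatsFrom-∷ : ∀ a b u → repeatsFrom a (b ∷ u) ≡ adjRepeat a b + repeatsFrom b u
  repeatsFrom-∷ a b u with a ≟ b
  ... | yes _ = refl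
  ... | no _ = refl

  adjRepeat-≢ : ∀ {a b} → ¬ a ≡ b → adjRepeat a b ≡ 0
  adjRepeat-≢ {a} {b} a≢b with a ≟ b
  ... | yes a≡b = contradiction a≡b a≢b
  ... | no _ = refl

  adjRepeat-refl : ∀ a → adjRepeat a a ≡ 1
  adjRepeat-refl a with a ≟ a
  ... | yes _ = refl
  ... | no a≢a = contradiction refl a≢a

  adjRepeat-sym : ∀ a b → adjRepeat a b ≡ adjRepeat b a
  adjRepeat-sym a b with a ≟ b
  ... | yes refl = sym (adjRepeat-refl a)
  ... | no a≢b = sym (adjRepeat-≢ (λ b≡a → a≢b (sym b≡a)))

  adjRepeat-≢-≤1 : ∀ l {p q} → ¬ p ≡ q → adjRepeat l p + adjRepeat q l ≤ 1
  adjRepeat-≢-≤1 l {p} {q} p≢q with l ≟ p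
  ... | yes refl rewrite adjRepeat-≢ (λ q≡l → p≢q (sym q≡l)) = s≤s z≤n
  ... | no _ with q ≟ l
  ...   | yes _ = s≤s z≤n
  ...   | no _ = z≤n

  lastFrom : Fin n → List (Fin n) → Fin n
  lastFrom z [] = z
  lastFrom z (b ∷ u) = lastFrom b u

  repeats-++ : ∀ z u v → repeats (z ∷ u ++ v) ≡ repeats (z ∷ u) + repeats (lastFrom z u ∷ v)
  repeats-++ z [] v = refl
  repeats-++ z (b ∷ u) v = begin
    repeatsFrom z (b ∷ u ++ v)                                ≡⟨ repeatsFrom-∷ z b (u ++ v) ⟩
    adjRepeat z b + repeatsFrom b (u ++ v)                    ≡⟨ cong (adjRepeat z b +_) (repeats-++ b u v) ⟩
    adjRepeat z b + (repeatsFrom b u + repeats (l ∷ v))       ≡⟨ sym (+-assoc (adjRepeat z b) _ _) ⟩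
    (adjRepeat z b + repeatsFrom b u) + repeats (l ∷ v)       ≡⟨ cong (_+ repeats (l ∷ v)) (sym (repeatsFrom-∷ z b u)) ⟩
    repeatsFrom z (b ∷ u) + repeats (l ∷ v)                   ∎
    where
    open ≡-Reasoning
    l = lastFrom b u

  repeats-∷-≥ : ∀ a u → repeats u ≤ repeats (a ∷ u)
  repeats-∷-≥ a [] = z≤n
  repeats-∷-≥ a (b ∷ u) = subst (repeatsFrom b u ≤_) (sym (repeatsFrom-∷ a b u)) (m≤n+m _ _)

  repeats-superadditive : ∀ u v → repeats u + repeats v ≤ repeats (u ++ v)
  repeats-superadditive [] v = ≤-refl
  repeats-superadditive (z ∷ u) v = subst (repeatsFrom z u + repeats v ≤_) (sym (repeats-++ z u v))
    (+-monoʳ-≤ (repeatsFrom z u) (repeats-∷-≥ (lastFrom z u) v))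

  repeats-ʳ++ : ∀ z u ys → repeats (u ʳ++ z ∷ ys) ≡ repeatsFrom z u + repeats (z ∷ ys)
  repeats-ʳ++ z [] ys = refl
  repeats-ʳ++ z (b ∷ u) ys = begin
    repeats (u ʳ++ b ∷ z ∷ ys)                              ≡⟨ repeats-ʳ++ b u (z ∷ ys) ⟩
    repeatsFrom b u + repeatsFrom b (z ∷ ys)                ≡⟨ cong (repeatsFrom b u +_) (repeatsFrom-∷ b z ys) ⟩
    repeatsFrom b u + (adjRepeat b z + repeats (z ∷ ys))    ≡⟨ cong (λ k → repeatsFrom b u + (k + repeats (z ∷ ys))) (adjRepeat-sym b z) ⟩
    repeatsFrom b u + (adjRepeat z b + repeats (z ∷ ys))    ≡⟨ sym (+-assoc (repeatsFrom b u) _ _) ⟩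
    (repeatsFrom b u + adjRepeat z b) + repeats (z ∷ ys)    ≡⟨ cong (_+ repeats (z ∷ ys)) (+-comm (repeatsFrom b u) _) ⟩
    (adjRepeat z b + repeatsFrom b u) + repeats (z ∷ ys)    ≡⟨ cong (_+ repeats (z ∷ ys)) (sym (repeatsFrom-∷ z b u)) ⟩
    repeatsFrom z (b ∷ u) + repeats (z ∷ ys)                ∎
    where open ≡-Reasoning

  repeats-reverse : ∀ u → repeats (reverse u) ≡ repeats u
  repeats-reverse [] = refl
  repeats-reverse (z ∷ u) = trans (repeats-ʳ++ z u []) (+-identityʳ _)

  ʳ++-∷ : ∀ z u ys → ∃ λ zs → u ʳ++ z ∷ ys ≡ lastFrom z u ∷ zs
  ʳ++-∷ z [] ys = ys , refl
  ʳ++-∷ z (b ∷ u) ys = ʳ++-∷ b u (z ∷ ys)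

  repeats-mirror-≥ : ∀ u s → repeats u + (repeats s + repeats u) ≤ repeats (u ++ s ++ reverse u)
  repeats-mirror-≥ u s = begin
    repeats u + (repeats s + repeats u)              ≡⟨ cong (λ k → repeats u + (repeats s + k)) (sym (repeats-reverse u)) ⟩
    repeats u + (repeats s + repeats (reverse u))    ≤⟨ +-monoʳ-≤ (repeats u) (repeats-superadditive s (reverse u)) ⟩
    repeats u + repeats (s ++ reverse u)             ≤⟨ repeats-superadditive u (s ++ reverse u) ⟩
    repeats (u ++ s ++ reverse u)                    ∎
    where open ≤-Reasoning

  repeats-square : ∀ a u → repeats (a ∷ a ∷ u) ≡ suc (repeats (a ∷ u))
  repeats-square a u = trans (repeatsFrom-∷ a a u) (cong (_+ repeatsFrom a u) (adjRepeat-refl a))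

  repeats-two-squares : ∀ p q → 2 ≤ repeats (p ∷ q ∷ q ∷ p ∷ p ∷ q ∷ [])
  repeats-two-squares p q = begin
    2                                           ≤⟨ s≤s (s≤s z≤n) ⟩
    suc (suc (repeats (p ∷ q ∷ [])))            ≡⟨ cong suc (sym (repeats-square p (q ∷ []))) ⟩
    suc (repeats (p ∷ p ∷ q ∷ []))              ≤⟨ s≤s (repeats-∷-≥ q (p ∷ p ∷ q ∷ [])) ⟩
    suc (repeats (q ∷ p ∷ p ∷ q ∷ []))          ≡⟨ sym (repeats-square q (p ∷ p ∷ q ∷ [])) ⟩
    repeats (q ∷ q ∷ p ∷ p ∷ q ∷ [])            ≤⟨ repeats-∷-≥ p (q ∷ q ∷ p ∷ p ∷ q ∷ []) ⟩
    repeats (p ∷ q ∷ q ∷ p ∷ p ∷ q ∷ [])        ∎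
    where open ≤-Reasoning

  Alternating : Fin n → Fin n → List (Fin n) → Set
  Alternating x y u = AltFrom x y u ⊎ AltFrom y x u

  repeatsFrom-AltFrom : ∀ {a b u} → ¬ a ≡ b → AltFrom b a u → repeatsFrom a u ≡ 0
  repeatsFrom-AltFrom a≢b alt-nil = refl
  repeatsFrom-AltFrom {a} {b} a≢b (alt-cons {u} alt) =
    trans (repeatsFrom-∷ a b u) (cong₂ _+_ (adjRepeat-≢ a≢b) (repeatsFrom-AltFrom (λ b≡a → a≢b (sym b≡a)) alt))

  AltFrom-repeatsFrom : ∀ {a b} u → ¬ a ≡ b → All (λ c → c ≡ a ⊎ c ≡ b) u → repeatsFrom a u ≡ 0 → AltFrom b a u
  AltFrom-repeatsFrom [] a≢b _ _ = alt-nil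
  AltFrom-repeatsFrom {a} (_ ∷ u) a≢b (inj₁ refl ∷ _) noRep with () ← trans (sym (repeats-square a u)) noRep
  AltFrom-repeatsFrom {a} {b} (_ ∷ u) a≢b (inj₂ refl ∷ u∈ab) noRep =
    alt-cons (AltFrom-repeatsFrom u (λ b≡a → a≢b (sym b≡a)) (All.map swap u∈ab)
      (trans (sym (cong (_+ repeatsFrom b u) (adjRepeat-≢ a≢b))) (trans (sym (repeatsFrom-∷ a b u)) noRep)))

  Alternating⇒noRepeats : ∀ {x y u} → ¬ x ≡ y → Alternating x y u → repeats u ≡ 0
  Alternating⇒noRepeats x≢y (inj₁ alt-nil) = refl
  Alternating⇒noRepeats x≢y (inj₂ alt-nil) = refl
  Alternating⇒noRepeats x≢y (inj₁ (alt-cons alt)) = repeatsFrom-AltFrom x≢y alt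
  Alternating⇒noRepeats x≢y (inj₂ (alt-cons alt)) = repeatsFrom-AltFrom (λ y≡x → x≢y (sym y≡x)) alt

  noRepeats⇒Alternating : ∀ {x y} u → ¬ x ≡ y → All (λ c → c ≡ x ⊎ c ≡ y) u → repeats u ≡ 0 → Alternating x y u
  noRepeats⇒Alternating [] x≢y _ _ = inj₁ alt-nil
  noRepeats⇒Alternating (_ ∷ u) x≢y (inj₁ refl ∷ u∈xy) noRep =
    inj₁ (alt-cons (AltFrom-repeatsFrom u x≢y u∈xy noRep))
  noRepeats⇒Alternating (_ ∷ u) x≢y (inj₂ refl ∷ u∈xy) noRep =
    inj₂ (alt-cons (AltFrom-repeatsFrom u (λ y≡x → x≢y (sym y≡x)) (All.map swap u∈xy) noRep))

  repeats-alternating-block : ∀ {p q} → ¬ p ≡ q → repeats (p ∷ q ∷ p ∷ q ∷ p ∷ q ∷ []) ≡ 0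
  repeats-alternating-block p≢q = repeatsFrom-AltFrom p≢q (alt-cons (alt-cons (alt-cons (alt-cons (alt-cons alt-nil)))))

  repeats-mirror-alternating : ∀ u {p q} → repeats u ≡ 0 → ¬ p ≡ q →
    repeats (u ++ (p ∷ q ∷ p ∷ q ∷ p ∷ q ∷ []) ++ reverse u) ≤ 1
  repeats-mirror-alternating [] _ p≢q = subst (_≤ 1) (sym (repeats-alternating-block p≢q)) z≤n
  repeats-mirror-alternating (z ∷ u) {p} {q} noRep p≢q with ʳ++-∷ z u []
  ... | zs , rev≡ = subst (_≤ 1) (sym total) (adjRepeat-≢-≤1 l p≢q)
    where
    open ≡-Reasoning
    l = lastFrom z u
    S = p ∷ q ∷ p ∷ q ∷ p ∷ q ∷ []

    noRepRev : repeatsFrom l zs ≡ 0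
    noRepRev = trans (sym (cong repeats rev≡)) (trans (repeats-reverse (z ∷ u)) noRep)

    through : ∀ r → repeats (l ∷ S ++ r) ≡ adjRepeat l p + repeatsFrom q r
    through r = trans (repeatsFrom-∷ l p _) (cong (adjRepeat l p +_)
      (trans (repeats-++ p (q ∷ p ∷ q ∷ p ∷ q ∷ []) r) (cong (_+ repeatsFrom q r) (repeats-alternating-block p≢q))))

    total : repeats (z ∷ u ++ S ++ reverse (z ∷ u)) ≡ adjRepeat l p + adjRepeat q l
    total = begin
      repeats (z ∷ u ++ S ++ reverse (z ∷ u))                ≡⟨ repeats-++ z u (S ++ reverse (z ∷ u)) ⟩
      repeatsFrom z u + repeats (l ∷ S ++ reverse (z ∷ u))   ≡⟨ cong₂ _+_ noRep (cong (λ r → repeats (l ∷ S ++ r)) rev≡) ⟩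
      repeats (l ∷ S ++ l ∷ zs)                              ≡⟨ through (l ∷ zs) ⟩
      adjRepeat l p + repeatsFrom q (l ∷ zs)                 ≡⟨ cong (adjRepeat l p +_) (repeatsFrom-∷ q l zs) ⟩
      adjRepeat l p + (adjRepeat q l + repeatsFrom l zs)     ≡⟨ cong (λ k → adjRepeat l p + (adjRepeat q l + k)) noRepRev ⟩
      adjRepeat l p + (adjRepeat q l + 0)                    ≡⟨ cong (adjRepeat l p +_) (+-identityʳ _) ⟩
      adjRepeat l p + adjRepeat q l                          ∎

module _ {a p} {A : Set a} {P : A → Set p} (P? : Decidable P) where

  filter-ʳ++ : ∀ xs ys → filter P? (xs ʳ++ ys) ≡ filter P? xs ʳ++ filter P? ys
  filter-ʳ++ [] ys = refl
  filter-ʳ++ (x ∷ xs) ys with ih ← filter-ʳ++ xs (x ∷ ys) | does (P? x)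
  ... | true = ih
  ... | false = ih

  filter-reverse : ∀ xs → filter P? (reverse xs) ≡ reverse (filter P? xs)
  filter-reverse xs = filter-ʳ++ xs []

module _ {a} {A : Set a} where

  concatFin : ∀ {m} → (Fin m → List A) → List A
  concatFin {zero} F = []
  concatFin {suc m} F = F zero ++ concatFin (λ i → F (suc i))

  concatFin-cong : ∀ {m} {F G : Fin m → List A} → (∀ i → F i ≡ G i) → concatFin F ≡ concatFin G
  concatFin-cong {zero} F≡G = refl
  concatFin-cong {suc m} F≡G = cong₂ _++_ (F≡G zero) (concatFin-cong (λ i → F≡G (suc i)))

  concatFin-empty : ∀ {m} (F : Fin m → List A) → (∀ i → F i ≡ []) → concatFin F ≡ []
  concatFin-empty {zero} F F≡[] = refl
  concatFin-empty {suc m} F F≡[] rewrite F≡[] zero = concatFin-empty (λ i → F (suc i)) (λ i → F≡[] (suc i))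

  concatFin-single : ∀ {m} (F : Fin m → List A) c → (∀ i → ¬ i ≡ c → F i ≡ []) → concatFin F ≡ F c
  concatFin-single {suc m} F zero F≡[] =
    trans (cong (F zero ++_) (concatFin-empty _ (λ i → F≡[] (suc i) λ ()))) (++-identityʳ (F zero))
  concatFin-single {suc m} F (suc c) F≡[] rewrite F≡[] zero (λ ()) =
    concatFin-single (λ i → F (suc i)) c (λ i i≢c → F≡[] (suc i) (λ si≡sc → i≢c (suc-injective si≡sc)))

  concatFin-pair : ∀ {m} (F : Fin m → List A) c d → ¬ c ≡ d → (∀ i → ¬ i ≡ c → ¬ i ≡ d → F i ≡ []) →
    concatFin F ≡ F c ++ F d ⊎ concatFin F ≡ F d ++ F c
  concatFin-pair {suc m} F zero zero c≢d _ = contradiction refl c≢d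
  concatFin-pair {suc m} F zero (suc d) _ F≡[] =
    inj₁ (cong (F zero ++_) (concatFin-single _ d (λ i i≢d → F≡[] (suc i) (λ ()) (λ si≡sd → i≢d (suc-injective si≡sd)))))
  concatFin-pair {suc m} F (suc c) zero _ F≡[] =
    inj₂ (cong (F zero ++_) (concatFin-single _ c (λ i i≢c → F≡[] (suc i) (λ si≡sc → i≢c (suc-injective si≡sc)) (λ ()))))
  concatFin-pair {suc m} F (suc c) (suc d) c≢d F≡[] rewrite F≡[] zero (λ ()) (λ ()) =
    concatFin-pair (λ i → F (suc i)) c d (λ c≡d → c≢d (cong suc c≡d))
      (λ i i≢c i≢d → F≡[] (suc i) (λ si≡sc → i≢c (suc-injective si≡sc)) (λ si≡sd → i≢d (suc-injective si≡sd)))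

  filter-concatFin : ∀ {p} {P : A → Set p} (P? : Decidable P) {m} (F : Fin m → List A) →
    filter P? (concatFin F) ≡ concatFin (λ i → filter P? (F i))
  filter-concatFin P? {zero} F = refl
  filter-concatFin P? {suc m} F =
    trans (filter-++ P? (F zero) _) (cong (filter P? (F zero) ++_) (filter-concatFin P? (λ i → F (suc i))))

module _ {n : ℕ} {M : Fin n → Fin n → Set} (M? : ∀ x y → Dec (M x y))
         (M-sym : ∀ x y → M x y → M y x) (M-functional : ∀ x y z → M x y → M x z → y ≡ z) where

  matchRep : Fin n → Fin n
  matchRep v with any? (λ p → M? v p ×-dec p <? v)
  ... | yes (p , _) = p
  ... | no _ = v

  matchRep-spec : ∀ v → (∃ λ p → M v p × p < v × matchRep v ≡ p) ⊎ ((∀ p → M v p → ¬ p < v) × matchRep v ≡ v)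
  matchRep-spec v with any? (λ p → M? v p ×-dec p <? v)
  ... | yes (p , m , p<v) = inj₁ (p , m , p<v , refl)
  ... | no ∄p = inj₂ ((λ p m p<v → ∄p (p , m , p<v)) , refl)

  matchRep-edge : ∀ {a b} → M a b → b < a → matchRep a ≡ b × matchRep b ≡ b
  matchRep-edge {a} {b} m b<a with matchRep-spec a | matchRep-spec b
  ... | inj₂ (∄p , _) | _ = contradiction b<a (∄p b m)
  ... | inj₁ (p , m′ , _ , rep≡p) | inj₂ (_ , rep≡b) = trans rep≡p (M-functional a p b m′ m) , rep≡b
  ... | inj₁ _ | inj₁ (q , m′ , q<b , _) =
        contradiction (subst (_< b) (M-functional b q a m′ (M-sym a b m)) q<b) (<-asym b<a)

  matchRep-partner : ∀ {a b} → M a b → matchRep a ≡ matchRep b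
  matchRep-partner {a} {b} m with <-cmp a b
  ... | tri< a<b _ _ = let (rep-b , rep-a) = matchRep-edge (M-sym a b m) a<b in trans rep-a (sym rep-b)
  ... | tri≈ _ refl _ = refl
  ... | tri> _ _ b<a = let (rep-a , rep-b) = matchRep-edge m b<a in trans rep-a (sym rep-b)

  matchRep-≡ : ∀ {a b} → matchRep a ≡ matchRep b → a ≡ b ⊎ M a b
  matchRep-≡ {a} {b} e with matchRep-spec a | matchRep-spec b
  ... | inj₂ (_ , ea) | inj₂ (_ , eb) = inj₁ (trans (sym ea) (trans e eb))
  ... | inj₁ (p , mp , _ , ea) | inj₂ (_ , eb) = inj₂ (subst (M a) (trans (sym ea) (trans e eb)) mp)
  ... | inj₂ (_ , ea) | inj₁ (q , mq , _ , eb) = inj₂ (M-sym b a (subst (M b) (trans (sym eb) (trans (sym e) ea)) mq))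
  ... | inj₁ (p , mp , _ , ea) | inj₁ (q , mq , _ , eb) =
        inj₁ (M-functional p a b (M-sym a p mp) (M-sym b p (subst (M b) (trans (sym eb) (trans (sym e) ea)) mq)))

either? : ∀ {n} (x y : Fin n) → Decidable (λ z → z ≡ x ⊎ z ≡ y)
either? x y z = (z ≟ x) ⊎-dec (z ≟ y)

restrict-all : ∀ {n} (w : List (Fin n)) x y → All (λ z → z ≡ x ⊎ z ≡ y) (restrict w x y)
restrict-all w x y = all-filter (either? x y) w

alternate? : ∀ {n} (w : List (Fin n)) {x y} → ¬ x ≡ y → Dec (Alternate w x y)
alternate? w {x} {y} x≢y = map′ (noRepeats⇒Alternating _ x≢y (restrict-all w x y)) (Alternating⇒noRepeats x≢y)
  (repeats (restrict w x y) ℕ.≟ 0)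

restrict-mirror : ∀ {n} (w s : List (Fin n)) x y →
  restrict (w ++ s ++ reverse w) x y ≡ restrict w x y ++ restrict s x y ++ reverse (restrict w x y)
restrict-mirror w s x y = trans (filter-++ (either? x y) w (s ++ reverse w))
  (cong (restrict w x y ++_) (trans (filter-++ (either? x y) s (reverse w)) (cong (restrict s x y ++_) (filter-reverse (either? x y) w))))

module ClassWord {n : ℕ} (rep : Fin n → Fin n) where

  member : Fin n → Fin n → List (Fin n)
  member v z with rep z ≟ v
  ... | yes _ = z ∷ []
  ... | no _ = []

  block : Fin n → List (Fin n)
  block v = concatFin (member v)

  forward backward classWord : List (Fin n)
  forward = concatFin block
  backward = concatFin (λ v → reverse (block v))
  classWord = forward ++ backward ++ forward

  module _ {x y : Fin n} (x≢y : ¬ x ≡ y) where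

    R : Fin n → List (Fin n)
    R v = restrict (block v) x y

    restrict-member-outside : ∀ v z → ¬ z ≡ x → ¬ z ≡ y → restrict (member v z) x y ≡ []
    restrict-member-outside v z z≢x z≢y with rep z ≟ v
    ... | yes _ = filter-reject (either? x y) [ z≢x , z≢y ]
    ... | no _ = refl

    restrict-member-other : ∀ v z → ¬ rep z ≡ v → restrict (member v z) x y ≡ []
    restrict-member-other v z rep≢v with rep z ≟ v
    ... | yes rep≡v = contradiction rep≡v rep≢v
    ... | no _ = refl

    restrict-member-inside : ∀ v z → z ≡ x ⊎ z ≡ y → rep z ≡ v → restrict (member v z) x y ≡ z ∷ []
    restrict-member-inside v z z∈xy rep≡v with rep z ≟ v
    ... | yes _ = filter-accept (either? x y) z∈xy
    ... | no rep≢v = contradiction rep≡v rep≢v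

    R-concat : ∀ v → R v ≡ concatFin (λ z → restrict (member v z) x y)
    R-concat v = filter-concatFin (either? x y) (member v)

    R-other : ∀ v → ¬ v ≡ rep x → ¬ v ≡ rep y → R v ≡ []
    R-other v v≢rx v≢ry = trans (R-concat v) (concatFin-empty _ empty)
      where
      empty : ∀ z → restrict (member v z) x y ≡ []
      empty z with z ≟ x | z ≟ y
      ... | yes refl | _ = restrict-member-other v z (λ rep≡v → v≢rx (sym rep≡v))
      ... | no _ | yes refl = restrict-member-other v z (λ rep≡v → v≢ry (sym rep≡v))
      ... | no z≢x | no z≢y = restrict-member-outside v z z≢x z≢y

    restrict-classWord : restrict classWord x y ≡
      concatFin R ++ concatFin (λ v → reverse (R v)) ++ concatFin R
    restrict-classWord = begin
      restrict classWord x y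
        ≡⟨ trans (filter-++ (either? x y) forward _) (cong (restrict forward x y ++_) (filter-++ (either? x y) backward forward)) ⟩
      restrict forward x y ++ restrict backward x y ++ restrict forward x y
        ≡⟨ cong₂ (λ f b → f ++ b ++ f) (filter-concatFin (either? x y) block)
             (trans (filter-concatFin (either? x y) (λ v → reverse (block v))) (concatFin-cong (λ v → filter-reverse (either? x y) (block v)))) ⟩
      concatFin R ++ concatFin (λ v → reverse (R v)) ++ concatFin R ∎
      where open ≡-Reasoning

    module _ (rx≢ry : ¬ rep x ≡ rep y) where

      R-x : R (rep x) ≡ x ∷ []
      R-x = trans (R-concat (rep x)) (trans (concatFin-single _ x only-x) (restrict-member-inside (rep x) x (inj₁ refl) refl))
        where
        only-x : ∀ z → ¬ z ≡ x → restrict (member (rep x) z) x y ≡ []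
        only-x z z≢x with z ≟ y
        ... | yes refl = restrict-member-other (rep x) z (λ ry≡rx → rx≢ry (sym ry≡rx))
        ... | no z≢y = restrict-member-outside (rep x) z z≢x z≢y

      R-y : R (rep y) ≡ y ∷ []
      R-y = trans (R-concat (rep y)) (trans (concatFin-single _ y only-y) (restrict-member-inside (rep y) y (inj₂ refl) refl))
        where
        only-y : ∀ z → ¬ z ≡ y → restrict (member (rep y) z) x y ≡ []
        only-y z z≢y with z ≟ x
        ... | yes refl = restrict-member-other (rep y) z rx≢ry
        ... | no z≢x = restrict-member-outside (rep y) z z≢x z≢y

      reverse-R : ∀ v → reverse (R v) ≡ R v
      reverse-R v with v ≟ rep x | v ≟ rep y
      ... | yes refl | _ = trans (cong reverse R-x) (sym R-x)
      ... | no _ | yes refl = trans (cong reverse R-y) (sym R-y)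
      ... | no v≢rx | no v≢ry = trans (cong reverse (R-other v v≢rx v≢ry)) (sym (R-other v v≢rx v≢ry))

      restrict-classWord-thrice : ∀ {p q} → concatFin R ≡ p ∷ q ∷ [] →
        restrict classWord x y ≡ p ∷ q ∷ p ∷ q ∷ p ∷ q ∷ []
      restrict-classWord-thrice τ≡ =
        trans restrict-classWord (cong₂ (λ f b → f ++ b ++ f) τ≡ (trans (concatFin-cong reverse-R) τ≡))

      classWord-separated : ∃ λ p → ∃ λ q → ¬ p ≡ q × restrict classWord x y ≡ p ∷ q ∷ p ∷ q ∷ p ∷ q ∷ []
      classWord-separated with concatFin-pair R (rep x) (rep y) rx≢ry R-other
      ... | inj₁ τ≡ = x , y , x≢y , restrict-classWord-thrice (trans τ≡ (cong₂ _++_ R-x R-y))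
      ... | inj₂ τ≡ = y , x , (λ y≡x → x≢y (sym y≡x)) , restrict-classWord-thrice (trans τ≡ (cong₂ _++_ R-y R-x))

    module _ (rx≡ry : rep x ≡ rep y) where

      R-away : ∀ v → ¬ v ≡ rep x → R v ≡ []
      R-away v v≢rx = R-other v v≢rx (λ v≡ry → v≢rx (trans v≡ry (sym rx≡ry)))

      R-rep : R (rep x) ≡ x ∷ y ∷ [] ⊎ R (rep x) ≡ y ∷ x ∷ []
      R-rep = Sum.map (λ τ≡ → trans (R-concat (rep x)) (trans τ≡ (cong₂ _++_ at-x at-y)))
                      (λ τ≡ → trans (R-concat (rep x)) (trans τ≡ (cong₂ _++_ at-y at-x)))
                      (concatFin-pair (λ z → restrict (member (rep x) z) x y) x y x≢y
                        (λ z z≢x z≢y → restrict-member-outside (rep x) z z≢x z≢y))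
        where
        at-x = restrict-member-inside (rep x) x (inj₁ refl) refl
        at-y = restrict-member-inside (rep x) y (inj₂ refl) (sym rx≡ry)

      restrict-classWord-single : restrict classWord x y ≡ R (rep x) ++ reverse (R (rep x)) ++ R (rep x)
      restrict-classWord-single = trans restrict-classWord
        (cong₂ (λ f b → f ++ b ++ f) (concatFin-single R (rep x) R-away)
          (concatFin-single (λ v → reverse (R v)) (rep x) (λ v v≢rx → cong reverse (R-away v v≢rx))))

      classWord-together : ∃ λ p → ∃ λ q → restrict classWord x y ≡ p ∷ q ∷ q ∷ p ∷ p ∷ q ∷ []
      classWord-together with R-rep
      ... | inj₁ R≡ = x , y , trans restrict-classWord-single (cong (λ r → r ++ reverse r ++ r) R≡)
      ... | inj₂ R≡ = y , x , trans restrict-classWord-single (cong (λ r → r ++ reverse r ++ r) R≡)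

repeats-mirror-≤1 : ∀ {n} (u s : List (Fin n)) → repeats (u ++ s ++ reverse u) ≤ 1 → repeats u ≡ 0 × repeats s ≤ 1
repeats-mirror-≤1 u s le = bound (repeats u) (repeats s) (≤-trans (repeats-mirror-≥ u s) le)
  where
  bound : ∀ k t → k + (t + k) ≤ 1 → k ≡ 0 × t ≤ 1
  bound zero t le = refl , subst (_≤ 1) (+-identityʳ t) le
  bound (suc k) t (s≤s le) with () ← ≤-trans (subst (_≤ k + (t + suc k)) (+-suc t k) (m≤n+m _ k)) le

module _ {n : ℕ} {H M : Fin n → Fin n → Set} (am : IsAddedMatching H M) (w : List (Fin n))
         (represents : ∀ x y → ¬ x ≡ y → Alternate w x y ⇔ addEdges H M x y) where

  open IsAddedMatching am

  M? : ∀ x y → Dec (M x y)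
  M? x y with x ≟ y
  ... | yes refl = no (irreflexive x)
  ... | no x≢y with alternate? w x≢y
  ...   | no ¬alt = no (λ m → ¬alt (Equivalence.from (represents x y x≢y) (inj₂ m)))
  ...   | yes alt with Equivalence.to (represents x y x≢y) alt
  ...     | inj₁ h = no (λ m → new x y m h)
  ...     | inj₂ m = yes m

  rep : Fin n → Fin n
  rep = matchRep M? symmetric disjoint

  rep-separated : ∀ {x y} → ¬ x ≡ y → H x y → ¬ rep x ≡ rep y
  rep-separated x≢y h rx≡ry with matchRep-≡ M? symmetric disjoint rx≡ry
  ... | inj₁ x≡y = x≢y x≡y
  ... | inj₂ m = new _ _ m h

  open ClassWord rep

  oneElevenWord : List (Fin n)
  oneElevenWord = w ++ classWord ++ reverse w

  oneElevenWord-represents : ∀ x y → ¬ x ≡ y → repeats (restrict oneElevenWord x y) ≤ 1 ⇔ H x y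
  oneElevenWord-represents x y x≢y rewrite restrict-mirror w classWord x y = mk⇔ to from
    where
    open Equivalence (represents x y x≢y) using () renaming (to to edge; from to alternates)
    u = restrict w x y
    s = restrict classWord x y

    to : repeats (u ++ s ++ reverse u) ≤ 1 → H x y
    to le with repeats-mirror-≤1 u s le
    ... | noRep , s≤1 with edge (noRepeats⇒Alternating u x≢y (restrict-all w x y) noRep)
    ...   | inj₁ h = h
    ...   | inj₂ m with classWord-together x≢y (matchRep-partner M? symmetric disjoint m)
    ...     | p , q , s≡ = contradiction (≤-trans (subst (λ t → 2 ≤ repeats t) (sym s≡) (repeats-two-squares p q)) s≤1)
                             λ { (s≤s ()) }

    from : H x y → repeats (u ++ s ++ reverse u) ≤ 1
    from h with classWord-separated x≢y (rep-separated x≢y h)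
    ... | p , q , p≢q , s≡ = subst (λ t → repeats (u ++ t ++ reverse u) ≤ 1) (sym s≡)
      (repeats-mirror-alternating u (Alternating⇒noRepeats x≢y (alternates (inj₁ h))) p≢q)

mainTheorem4 : (n : ℕ) (H M : Fin n → Fin n → Set) →
    IsSimpleGraph H → IsAddedMatching H M →
    WordRepresentable (addEdges H M) → OneElevenRepresentable H
mainTheorem4 n H M _ am (w , occurs , represents) =
  oneElevenWord am w represents , (λ v → ∈-++⁺ˡ (occurs v)) , oneElevenWord-represents am w represents
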